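{- Let $k\ge 2$, $n\ge 3$ and $k,n\in\mathbb{N}$. The cycle $C_n$ is $k$-distance magic if and only if $n=4k$.
   Context: All graphs are finite, simple and undirected; $d(u,v)$ is graph distance. For $u\in V(G)$ and $k\in\mathbb{N}$, $\partial N_k(u)=\{v\in V(G): d(u,v)=k\}$. For a graph $G$ of order $n\ge3$, a $k$-distance magic labeling ($k$-DML) is a bijection $f:V(G)\to\{1,\dots,n\}$ together with a constant $M$ such that $\sum_{w\in\partial N_k(u)} f(w)=M$ for every vertex $u$ with $\partial N_k(u)\neq\emptyset$; moreover $G$ is required to contain at least one pair of vertices at distance $k$. $G$ is $k$-distance magic ($k$-DM) if it has a $k$-DML. -}

module Defs where

open import Data.Nat using (ℕ; zero; suc; _<_)
open import Data.Fin using (Fin; toℕ)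
open import Data.List using (List; map)
open import Data.Nat.ListAction using (sum)
open import Data.List.Relation.Unary.Unique.Propositional using (Unique)
open import Data.List.Membership.Propositional using (_∈_)
open import Data.Product using (Σ; ∃; _×_; _,_)
open import Data.Sum using (_⊎_)
open import Relation.Nullary using (¬_)
open import Relation.Binary.PropositionalEquality using (_≡_)
open import Function.Bundles using (_⤖_; Bijection; _⇔_)

record Graph (n : ℕ) : Set₁ where
  field
    Adj : Fin n → Fin n → Set

open Graph public

data Walk {n : ℕ} (G : Graph n) : Fin n → Fin n → ℕ → Set where
  here : ∀ {u} → Walk G u u zero
  step : ∀ {u w v ℓ} → Adj G u w → Walk G w v ℓ → Walk G u v (suc ℓ)

Dist : ∀ {n} → Graph n → Fin n → Fin n → ℕ → Set
Dist G u v k = Walk G u v k × (∀ ℓ → ℓ < k → ¬ Walk G u v ℓ)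

CycleStep : (n : ℕ) → Fin n → Fin n → Set
CycleStep n u v = (toℕ v ≡ suc (toℕ u)) ⊎ ((suc (toℕ u) ≡ n) × (toℕ v ≡ 0))

Cycle : (n : ℕ) → Graph n
Cycle n = record { Adj = λ u v → CycleStep n u v ⊎ CycleStep n v u }

label : ∀ {n} → (Fin n ⤖ Fin n) → Fin n → ℕ
label g w = suc (toℕ (Bijection.to g w))

-- The sum of f over ∂N_k(u) equals M: the sphere is enumerated by a
-- duplicate-free list L.
SphereSum : ∀ {n} → Graph n → ℕ → (Fin n → ℕ) → Fin n → ℕ → Set
SphereSum G k f u M =
  Σ (List (Fin _)) λ L → Unique L × (∀ w → (w ∈ L) ⇔ Dist G u w k) × (sum (map f L) ≡ M)

IsKDML : ∀ {n} → Graph n → ℕ → (Fin n ⤖ Fin n) → ℕ → Set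
IsKDML G k g M = ∀ u → (∃ λ w → Dist G u w k) → SphereSum G k (label g) u M

KDistanceMagic : ∀ {n} → Graph n → ℕ → Set
KDistanceMagic {n} G k =
  (∃ λ u → ∃ λ v → Dist G u v k) ×
  (Σ (Fin n ⤖ Fin n) λ g → ∃ λ M → IsKDML G k g M)

module Submission where

-- Label the vertices of C_n by Z/n, so that ∂N_k(u) = {u + k, u − k} when 2k < n and
-- ∂N_k(u) = {u + k} when 2k = n (and is empty when 2k > n).  In the second case the magic
-- condition says that every label equals M, contradicting injectivity.  In the first,
-- f(x + 2k) + f(x) = M for every x (the sphere around x + k), hence f(x + 4k) = f(x), so
-- n divides 4k < 2n and n = 4k.  Conversely, for n = 4k = 2m antipodal vertices are exactly
-- the pairs (i, i + m); keeping the labels of the lower half and reversing those of the upper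
-- half makes every antipodal pair sum to n + 1.

open import Defs
open import Data.Empty using (⊥; ⊥-elim)
open import Data.Fin using (Fin; toℕ; fromℕ<; splitAt; join; _↑ˡ_; _↑ʳ_; opposite)
open import Data.Fin.Properties
  using (toℕ-injective; toℕ<n; toℕ-fromℕ<; splitAt-join; join-splitAt; splitAt-↑ˡ; splitAt-↑ʳ;
         toℕ-↑ˡ; toℕ-↑ʳ; opposite-prop; opposite-involutive)
open import Data.List using (List; []; _∷_; map)
open import Data.List.Membership.Propositional using (_∈_)
open import Data.List.Membership.Propositional.Properties.WithK using (unique∧set⇒bag)
open import Data.List.Relation.Binary.BagAndSetEquality using (∼bag⇒↭)
open import Data.List.Relation.Binary.Permutation.Propositional.Properties using (map⁺)
open import Data.List.Relation.Unary.All using ([]; _∷_)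
open import Data.List.Relation.Unary.AllPairs using ([]; _∷_)
open import Data.List.Relation.Unary.Any using (here; there)
open import Data.List.Relation.Unary.Unique.Propositional using (Unique)
open import Data.Nat using (ℕ; zero; suc; _+_; _*_; _∸_; _≤_; _<_; z≤n; z<s; s≤s; NonZero; >-nonZero⁻¹)
open import Data.Nat.DivMod
  using (_%_; _mod_; %-distribˡ-+; m%n%n≡m%n; m%n<n; n%n≡0; m<n⇒m%n≡m; [m+n]%n≡m%n; m≤n⇒[n∸m]%m≡n%m)
open import Data.Nat.ListAction using (sum)
open import Data.Nat.ListAction.Properties using (sum-↭)
open import Data.Nat.Properties
open import Algebra.Properties.CommutativeSemigroup +-commutativeSemigroup using (x∙yz≈y∙xz)
open import Data.Nat.Tactic.RingSolver using (solve-∀)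
open import Data.Product using (∃-syntax; _×_; _,_; proj₁; proj₂)
open import Data.Sum using (_⊎_; inj₁; inj₂; map₂)
open import Function.Base using (_∘_)
open import Function.Bundles using (_⇔_; mk⇔; Equivalence; _⤖_; Bijection; mk↔ₛ′)
import Function.Properties.Equivalence as ⇔
open import Function.Properties.Inverse using (↔⇒⤖)
open import Relation.Binary.PropositionalEquality
open import Relation.Nullary using (¬_; contradiction)

[m%d+n]%d≡[m+n]%d : ∀ m n d .{{_ : NonZero d}} → (m % d + n) % d ≡ (m + n) % d
[m%d+n]%d≡[m+n]%d m n d = begin
  (m % d + n) % d         ≡⟨ %-distribˡ-+ (m % d) n d ⟩
  (m % d % d + n % d) % d ≡⟨ cong (λ x → (x + n % d) % d) (m%n%n≡m%n m d) ⟩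
  (m % d + n % d) % d     ≡⟨ %-distribˡ-+ m n d ⟨
  (m + n) % d             ∎
  where open ≡-Reasoning

m%n≡0⇒m≡n : ∀ {m n} .{{_ : NonZero n}} → 0 < m → m < n + n → m % n ≡ 0 → m ≡ n
m%n≡0⇒m≡n {m} {n} 0<m m<2n m%n≡0 with <-≤-connex m n
... | inj₁ m<n = contradiction (trans (sym (m<n⇒m%n≡m m<n)) m%n≡0) (>⇒≢ 0<m)
... | inj₂ n≤m = ≤-antisym (m∸n≡0⇒m≤n (begin
  m ∸ n       ≡⟨ m<n⇒m%n≡m (+-cancelʳ-< n (m ∸ n) n (subst (_< n + n) (sym (m∸n+n≡m n≤m)) m<2n)) ⟨
  (m ∸ n) % n ≡⟨ m≤n⇒[n∸m]%m≡n%m n≤m ⟩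
  m % n       ≡⟨ m%n≡0 ⟩
  0           ∎)) n≤m
  where open ≡-Reasoning

4*k≡k+k+[k+k] : ∀ k → 4 * k ≡ k + k + (k + k)
4*k≡k+k+[k+k] = solve-∀

SphereSum⇒≡sum : ∀ {n} {G : Graph n} {k f u M} {L : List (Fin n)} →
  Unique L → (∀ w → w ∈ L ⇔ Dist G u w k) → SphereSum G k f u M → M ≡ sum (map f L)
SphereSum⇒≡sum {f = f} uniq ∈L⇔ (L′ , uniq′ , ∈L′⇔ , refl) =
  sum-↭ (map⁺ f (∼bag⇒↭ (unique∧set⇒bag uniq′ uniq λ {w} → ⇔.trans (∈L′⇔ w) (⇔.sym (∈L⇔ w)))))

∈-pair⇔ : ∀ {A : Set} {a b w : A} → w ∈ a ∷ b ∷ [] ⇔ (w ≡ a ⊎ w ≡ b)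
∈-pair⇔ {a = a} {b} {w} = mk⇔ to from
  where
  to : w ∈ a ∷ b ∷ [] → w ≡ a ⊎ w ≡ b
  to (here w≡a) = inj₁ w≡a
  to (there (here w≡b)) = inj₂ w≡b
  from : w ≡ a ⊎ w ≡ b → w ∈ a ∷ b ∷ []
  from (inj₁ w≡a) = here w≡a
  from (inj₂ w≡b) = there (here w≡b)

module _ {n : ℕ} {{_ : NonZero n}} where

  infixl 6 _⊕_ _⊖_

  _⊕_ : Fin n → ℕ → Fin n
  u ⊕ d = (toℕ u + d) mod n

  -- u ⊖ d is u − d only for d ≤ n, because of truncated subtraction.
  _⊖_ : Fin n → ℕ → Fin n
  u ⊖ d = u ⊕ (n ∸ d)

  toℕ-⊕ : ∀ u d → toℕ (u ⊕ d) ≡ (toℕ u + d) % n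
  toℕ-⊕ u d = toℕ-fromℕ< (m%n<n (toℕ u + d) n)

  ⊕-assoc : ∀ u a b → u ⊕ a ⊕ b ≡ u ⊕ (a + b)
  ⊕-assoc u a b = toℕ-injective (begin
    toℕ (u ⊕ a ⊕ b)           ≡⟨ toℕ-⊕ (u ⊕ a) b ⟩
    (toℕ (u ⊕ a) + b) % n     ≡⟨ cong (λ x → (x + b) % n) (toℕ-⊕ u a) ⟩
    ((toℕ u + a) % n + b) % n ≡⟨ [m%d+n]%d≡[m+n]%d (toℕ u + a) b n ⟩
    (toℕ u + a + b) % n       ≡⟨ cong (_% n) (+-assoc (toℕ u) a b) ⟩
    (toℕ u + (a + b)) % n     ≡⟨ toℕ-⊕ u (a + b) ⟨
    toℕ (u ⊕ (a + b))         ∎)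
    where open ≡-Reasoning

  ⊕-identityʳ : ∀ u → u ⊕ 0 ≡ u
  ⊕-identityʳ u = toℕ-injective (begin
    toℕ (u ⊕ 0)       ≡⟨ toℕ-⊕ u 0 ⟩
    (toℕ u + 0) % n   ≡⟨ cong (_% n) (+-identityʳ (toℕ u)) ⟩
    toℕ u % n         ≡⟨ m<n⇒m%n≡m (toℕ<n u) ⟩
    toℕ u             ∎)
    where open ≡-Reasoning

  ⊕-period : ∀ u → u ⊕ n ≡ u
  ⊕-period u = toℕ-injective (begin
    toℕ (u ⊕ n)       ≡⟨ toℕ-⊕ u n ⟩
    (toℕ u + n) % n   ≡⟨ [m+n]%n≡m%n (toℕ u) n ⟩
    toℕ u % n         ≡⟨ m<n⇒m%n≡m (toℕ<n u) ⟩
    toℕ u             ∎)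
    where open ≡-Reasoning

  ⊕-⊖ : ∀ {d} → d ≤ n → ∀ u → u ⊕ d ⊖ d ≡ u
  ⊕-⊖ {d} d≤n u = trans (⊕-assoc u d (n ∸ d)) (trans (cong (u ⊕_) (m+[n∸m]≡n d≤n)) (⊕-period u))

  ⊖-⊕ : ∀ {d} → d ≤ n → ∀ u → u ⊖ d ⊕ d ≡ u
  ⊖-⊕ {d} d≤n u = trans (⊕-assoc u (n ∸ d) d) (trans (cong (u ⊕_) (m∸n+n≡m d≤n)) (⊕-period u))

  ⊕-cancelʳ : ∀ {d} → d ≤ n → ∀ {u v} → u ⊕ d ≡ v ⊕ d → u ≡ v
  ⊕-cancelʳ {d} d≤n {u} {v} eq = trans (sym (⊕-⊖ d≤n u)) (trans (cong (_⊖ d) eq) (⊕-⊖ d≤n v))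

  -- Shifting back by toℕ u moves u to 0, so only the residue of the shift is left.
  ⊕-cancelˡ : ∀ u {a b} → u ⊕ a ≡ u ⊕ b → a % n ≡ b % n
  ⊕-cancelˡ u {a} {b} eq = trans (residue a) (trans (cong (λ v → toℕ (v ⊖ toℕ u)) eq) (sym (residue b)))
    where
    open ≡-Reasoning
    residue : ∀ a → a % n ≡ toℕ (u ⊕ a ⊖ toℕ u)
    residue a = begin
      a % n                           ≡⟨ [m+n]%n≡m%n a n ⟨
      (a + n) % n                     ≡⟨ cong (λ x → (a + x) % n) (m+[n∸m]≡n (<⇒≤ (toℕ<n u))) ⟨
      (a + (toℕ u + (n ∸ toℕ u))) % n ≡⟨ cong (_% n) (x∙yz≈y∙xz a (toℕ u) (n ∸ toℕ u)) ⟩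
      (toℕ u + (a + (n ∸ toℕ u))) % n ≡⟨ toℕ-⊕ u (a + (n ∸ toℕ u)) ⟨
      toℕ (u ⊕ (a + (n ∸ toℕ u)))     ≡⟨ cong toℕ (⊕-assoc u a (n ∸ toℕ u)) ⟨
      toℕ (u ⊕ a ⊖ toℕ u)             ∎

  ⊕-injectiveʳ : ∀ u {a b} → a < n → b < n → u ⊕ a ≡ u ⊕ b → a ≡ b
  ⊕-injectiveʳ u {a} {b} a<n b<n eq =
    trans (sym (m<n⇒m%n≡m a<n)) (trans (⊕-cancelˡ u eq) (m<n⇒m%n≡m b<n))

  ⊕-fixed : ∀ u {d} → u ⊕ d ≡ u → d % n ≡ 0
  ⊕-fixed u {d} eq = trans (⊕-cancelˡ u (trans eq (sym (⊕-identityʳ u)))) (m<n⇒m%n≡m (>-nonZero⁻¹ n))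

  ⊕-suc : ∀ (u : Fin n) d → u ⊕ d ⊕ 1 ≡ u ⊕ suc d
  ⊕-suc u d = trans (⊕-assoc u d 1) (cong (u ⊕_) (+-comm d 1))

  toℕ-⊕1 : ∀ u → toℕ (u ⊕ 1) ≡ suc (toℕ u) % n
  toℕ-⊕1 u = trans (toℕ-⊕ u 1) (cong (_% n) (+-comm (toℕ u) 1))

  CycleStep⇒≡⊕1 : ∀ {u v} → CycleStep n u v → v ≡ u ⊕ 1
  CycleStep⇒≡⊕1 {u} {v} (inj₁ v≡1+u) = toℕ-injective (begin
    toℕ v             ≡⟨ v≡1+u ⟩
    suc (toℕ u)       ≡⟨ m<n⇒m%n≡m (subst (_< n) v≡1+u (toℕ<n v)) ⟨
    suc (toℕ u) % n   ≡⟨ toℕ-⊕1 u ⟨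
    toℕ (u ⊕ 1)       ∎)
    where open ≡-Reasoning
  CycleStep⇒≡⊕1 {u} {v} (inj₂ (1+u≡n , v≡0)) = toℕ-injective (begin
    toℕ v             ≡⟨ v≡0 ⟩
    0                 ≡⟨ n%n≡0 n ⟨
    n % n             ≡⟨ cong (_% n) 1+u≡n ⟨
    suc (toℕ u) % n   ≡⟨ toℕ-⊕1 u ⟨
    toℕ (u ⊕ 1)       ∎)
    where open ≡-Reasoning

  CycleStep-⊕1 : ∀ u → CycleStep n u (u ⊕ 1)
  CycleStep-⊕1 u with m≤n⇒m<n∨m≡n (toℕ<n u)
  ... | inj₁ 1+u<n = inj₁ (trans (toℕ-⊕1 u) (m<n⇒m%n≡m 1+u<n))
  ... | inj₂ 1+u≡n = inj₂ (1+u≡n , trans (toℕ-⊕1 u) (trans (cong (_% n) 1+u≡n) (n%n≡0 n)))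

  Apart : ℕ → Fin n → Fin n → Set
  Apart d u v = v ≡ u ⊕ d ⊎ u ≡ v ⊕ d

  Adj⇒Apart1 : ∀ {u v} → Adj (Cycle n) u v → Apart 1 u v
  Adj⇒Apart1 (inj₁ u→v) = inj₁ (CycleStep⇒≡⊕1 u→v)
  Adj⇒Apart1 (inj₂ v→u) = inj₂ (CycleStep⇒≡⊕1 v→u)

  walk-⊕ : ∀ u d → Walk (Cycle n) u (u ⊕ d) d
  walk-⊕ u zero = subst (λ v → Walk (Cycle n) u v 0) (sym (⊕-identityʳ u)) here
  walk-⊕ u (suc d) =
    step (inj₁ (CycleStep-⊕1 u)) (subst (λ v → Walk (Cycle n) (u ⊕ 1) v d) (⊕-assoc u 1 d) (walk-⊕ (u ⊕ 1) d))

  walk-⊖ : ∀ u d → Walk (Cycle n) (u ⊕ d) u d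
  walk-⊖ u zero = subst (λ v → Walk (Cycle n) v u 0) (sym (⊕-identityʳ u)) here
  walk-⊖ u (suc d) = step (inj₂ back) (walk-⊖ u d)
    where
    back : CycleStep n (u ⊕ d) (u ⊕ suc d)
    back = subst (CycleStep n (u ⊕ d)) (⊕-suc u d) (CycleStep-⊕1 (u ⊕ d))

  Apart⇒Walk : ∀ {d u v} → Apart d u v → Walk (Cycle n) u v d
  Apart⇒Walk (inj₁ refl) = walk-⊕ _ _
  Apart⇒Walk (inj₂ refl) = walk-⊖ _ _

  Apart-step : ∀ {j u v w} → Apart 1 u w → Apart j w v → ∃[ i ] i ≤ suc j × Apart i u v
  Apart-step {j} {u} (inj₁ refl) (inj₁ refl) = suc j , ≤-refl , inj₁ (⊕-assoc u 1 j)
  Apart-step {j} {v = v} (inj₂ refl) (inj₂ refl) =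
    suc j , ≤-refl , inj₂ (⊕-suc v j)
  Apart-step {zero} {v = v} (inj₁ refl) (inj₂ u⊕1≡v⊕0) =
    1 , s≤s z≤n , inj₁ (trans (sym (⊕-identityʳ v)) (sym u⊕1≡v⊕0))
  Apart-step {suc j} {v = v} (inj₁ refl) (inj₂ u⊕1≡v⊕1+j) =
    j , m≤n+m j 2 , inj₂ (⊕-cancelʳ (>-nonZero⁻¹ n) (trans u⊕1≡v⊕1+j (sym (⊕-suc v j))))
  Apart-step {zero} {w = w} (inj₂ refl) (inj₁ refl) = 1 , s≤s z≤n , inj₂ (cong (_⊕ 1) (sym (⊕-identityʳ w)))
  Apart-step {suc j} {w = w} (inj₂ refl) (inj₁ refl) = j , m≤n+m j 2 , inj₁ (sym (⊕-assoc w 1 j))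

  Walk⇒Apart : ∀ {u v ℓ} → Walk (Cycle n) u v ℓ → ∃[ j ] j ≤ ℓ × Apart j u v
  Walk⇒Apart {u} here = 0 , z≤n , inj₁ (sym (⊕-identityʳ u))
  Walk⇒Apart (step adj walk) with Walk⇒Apart walk
  ... | j , j≤ℓ , apart with Apart-step (Adj⇒Apart1 adj) apart
  ... | i , i≤1+j , apart′ = i , ≤-trans i≤1+j (s≤s j≤ℓ) , apart′

  Apart-unique : ∀ {j k u v} → j + k < n → Apart j u v → Apart k u v → j ≡ k
  Apart-unique {j} {k} {u} {v} j+k<n = unique
    where
    j<n : j < n
    j<n = ≤-<-trans (m≤m+n j k) j+k<n
    k<n : k < n
    k<n = ≤-<-trans (m≤n+m k j) j+k<n
    loop : ∀ w → w ≡ w ⊕ j ⊕ k → j ≡ k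
    loop w eq = trans (m+n≡0⇒m≡0 j j+k≡0) (sym (m+n≡0⇒n≡0 j j+k≡0))
      where
      j+k≡0 : j + k ≡ 0
      j+k≡0 = trans (sym (m<n⇒m%n≡m j+k<n)) (⊕-fixed w (trans (sym (⊕-assoc w j k)) (sym eq)))
    unique : Apart j u v → Apart k u v → j ≡ k
    unique (inj₁ refl) (inj₁ eq) = ⊕-injectiveʳ u j<n k<n eq
    unique (inj₂ refl) (inj₂ eq) = ⊕-injectiveʳ v j<n k<n eq
    unique (inj₁ refl) (inj₂ eq) = loop u eq
    unique (inj₂ refl) (inj₁ eq) = loop v eq

  ⊕-mod : ∀ u d → u ⊕ (d % n) ≡ u ⊕ d
  ⊕-mod u d = toℕ-injective (begin
    toℕ (u ⊕ (d % n))       ≡⟨ toℕ-⊕ u (d % n) ⟩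
    (toℕ u + d % n) % n     ≡⟨ cong (_% n) (+-comm (toℕ u) (d % n)) ⟩
    (d % n + toℕ u) % n     ≡⟨ [m%d+n]%d≡[m+n]%d d (toℕ u) n ⟩
    (d + toℕ u) % n         ≡⟨ cong (_% n) (+-comm d (toℕ u)) ⟩
    (toℕ u + d) % n         ≡⟨ toℕ-⊕ u d ⟨
    toℕ (u ⊕ d)             ∎)
    where open ≡-Reasoning

  Apart-mod : ∀ {d u v} → Apart d u v → Apart (d % n) u v
  Apart-mod {d} {u} (inj₁ refl) = inj₁ (sym (⊕-mod u d))
  Apart-mod {d} {v = v} (inj₂ refl) = inj₂ (sym (⊕-mod v d))

  Apart-complement : ∀ {d u v} → d ≤ n → Apart d u v → Apart (n ∸ d) u v
  Apart-complement {u = u} d≤n (inj₁ refl) = inj₂ (sym (⊕-⊖ d≤n u))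
  Apart-complement {v = v} d≤n (inj₂ refl) = inj₁ (sym (⊕-⊖ d≤n v))

  Dist⇔Apart : ∀ {k u v} → Dist (Cycle n) u v k ⇔ (Apart k u v × k + k ≤ n)
  Dist⇔Apart {k} {u} {v} = mk⇔ to from
    where
    to : Dist (Cycle n) u v k → Apart k u v × k + k ≤ n
    -- k is minimal among the lengths of the walks from u to v, in particular below those of
    -- the walks of length k % n and n ∸ k obtained from the apartness itself.
    to (walk , shortest) = apartₖ , 2k≤n
      where
      minimal : ∀ {j} → Apart j u v → k ≤ j
      minimal apart = ≮⇒≥ λ j<k → shortest _ j<k (Apart⇒Walk apart)
      apartₖ : Apart k u v
      apartₖ with Walk⇒Apart walk
      ... | j , j≤k , apart = subst (λ i → Apart i u v) (≤-antisym j≤k (minimal apart)) apart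
      k≤n : k ≤ n
      k≤n = <⇒≤ (≤-<-trans (minimal (Apart-mod apartₖ)) (m%n<n k n))
      2k≤n : k + k ≤ n
      2k≤n = subst (k + k ≤_) (m+[n∸m]≡n k≤n) (+-monoʳ-≤ k (minimal (Apart-complement k≤n apartₖ)))
    from : Apart k u v × k + k ≤ n → Dist (Cycle n) u v k
    from (apart , 2k≤n) = Apart⇒Walk apart , noShorter
      where
      noShorter : ∀ ℓ → ℓ < k → ¬ Walk (Cycle n) u v ℓ
      noShorter ℓ ℓ<k walk with Walk⇒Apart walk
      ... | j , j≤ℓ , apartⱼ = <⇒≢ j<k (Apart-unique (<-≤-trans (+-monoˡ-< k j<k) 2k≤n) apartⱼ apart)
        where
        j<k : j < k
        j<k = ≤-<-trans j≤ℓ ℓ<k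

  Apart⇔⊕⊖ : ∀ {d u w} → d ≤ n → Apart d u w ⇔ (w ≡ u ⊕ d ⊎ w ≡ u ⊖ d)
  Apart⇔⊕⊖ {d} {u} {w} d≤n = mk⇔ to from
    where
    to : Apart d u w → w ≡ u ⊕ d ⊎ w ≡ u ⊖ d
    to (inj₁ w≡u⊕d) = inj₁ w≡u⊕d
    to (inj₂ refl) = inj₂ (sym (⊕-⊖ d≤n w))
    from : w ≡ u ⊕ d ⊎ w ≡ u ⊖ d → Apart d u w
    from (inj₁ w≡u⊕d) = inj₁ w≡u⊕d
    from (inj₂ refl) = inj₂ (sym (⊖-⊕ d≤n u))

  sphere : ℕ → Fin n → List (Fin n)
  sphere k u = u ⊕ k ∷ u ⊖ k ∷ []

  ∈-sphere⇔Dist : ∀ {k u} → k + k ≤ n → ∀ w → w ∈ sphere k u ⇔ Dist (Cycle n) u w k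
  ∈-sphere⇔Dist {k} {u} 2k≤n w = mk⇔
    (λ w∈ → Equivalence.from Dist⇔Apart (Equivalence.from apart⇔ (Equivalence.to ∈-pair⇔ w∈) , 2k≤n))
    (λ dist → Equivalence.from ∈-pair⇔ (Equivalence.to apart⇔ (proj₁ (Equivalence.to Dist⇔Apart dist))))
    where
    apart⇔ : Apart k u w ⇔ (w ≡ u ⊕ k ⊎ w ≡ u ⊖ k)
    apart⇔ = Apart⇔⊕⊖ (≤-trans (m≤m+n k k) 2k≤n)

  sphere-unique : ∀ {k u} → 0 < k → k + k < n → Unique (sphere k u)
  sphere-unique {k} {u} 0<k 2k<n = (u⊕k≢u⊖k ∷ []) ∷ [] ∷ []
    where
    u⊕k≢u⊖k : u ⊕ k ≢ u ⊖ k
    u⊕k≢u⊖k eq = >⇒≢ (<-≤-trans 0<k (m≤m+n k k)) (trans (sym (m<n⇒m%n≡m 2k<n)) (⊕-fixed u (begin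
      u ⊕ (k + k)  ≡⟨ ⊕-assoc u k k ⟨
      u ⊕ k ⊕ k    ≡⟨ cong (_⊕ k) eq ⟩
      u ⊖ k ⊕ k    ≡⟨ ⊖-⊕ (≤-trans (m≤m+n k k) (<⇒≤ 2k<n)) u ⟩
      u            ∎)))
      where open ≡-Reasoning

  ⊖-antipode : ∀ {k} → n ≡ k + k → ∀ u → u ⊖ k ≡ u ⊕ k
  ⊖-antipode {k} n≡2k u = cong (u ⊕_) (trans (cong (_∸ k) n≡2k) (m+n∸m≡n k k))

  ∈-antipode⇔Dist : ∀ {k u} → n ≡ k + k → ∀ w → w ∈ u ⊕ k ∷ [] ⇔ Dist (Cycle n) u w k
  ∈-antipode⇔Dist {k} {u} n≡2k w = mk⇔ (λ { (here refl) → Equivalence.to sphere⇔ (here refl) }) from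
    where
    sphere⇔ : w ∈ sphere k u ⇔ Dist (Cycle n) u w k
    sphere⇔ = ∈-sphere⇔Dist (≤-reflexive (sym n≡2k)) w
    from : Dist (Cycle n) u w k → w ∈ u ⊕ k ∷ []
    from dist with Equivalence.from sphere⇔ dist
    ... | here w≡u⊕k = here w≡u⊕k
    ... | there (here w≡u⊖k) = here (trans w≡u⊖k (⊖-antipode n≡2k u))

  Dist-⊕ : ∀ {k} → k + k ≤ n → ∀ u → Dist (Cycle n) u (u ⊕ k) k
  Dist-⊕ 2k≤n u = Equivalence.from Dist⇔Apart (inj₁ refl , 2k≤n)

label-injective : ∀ {n} (g : Fin n ⤖ Fin n) {x y} → label g x ≡ label g y → x ≡ y
label-injective g eq = Bijection.injective g (toℕ-injective (suc-injective eq))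

module _ {n : ℕ} {{_ : NonZero n}} {k : ℕ} {g : Fin n ⤖ Fin n} {M : ℕ} (magic : IsKDML (Cycle n) k g M) where

  M≡label[u⊕k]+label[u⊖k] : 0 < k → k + k < n → ∀ u → M ≡ label g (u ⊕ k) + label g (u ⊖ k)
  M≡label[u⊕k]+label[u⊖k] 0<k 2k<n u =
    trans (SphereSum⇒≡sum (sphere-unique 0<k 2k<n) (∈-sphere⇔Dist (<⇒≤ 2k<n))
                          (magic u (u ⊕ k , Dist-⊕ (<⇒≤ 2k<n) u)))
          (cong (label g (u ⊕ k) +_) (+-identityʳ _))

  M≡label[u⊕k] : n ≡ k + k → ∀ u → M ≡ label g (u ⊕ k)
  M≡label[u⊕k] n≡2k u =
    trans (SphereSum⇒≡sum ([] ∷ []) (∈-antipode⇔Dist n≡2k)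
                          (magic u (u ⊕ k , Dist-⊕ (≤-reflexive (sym n≡2k)) u)))
          (+-identityʳ _)

  -- Comparing the spheres around x ⊕ k and x ⊕ 3k shows that the labels are 4k-periodic.
  IsKDML⇒4k≡n : 0 < k → k + k < n → Fin n → k + k + (k + k) ≡ n
  IsKDML⇒4k≡n 0<k 2k<n x =
    m%n≡0⇒m≡n 0<4k (+-mono-< 2k<n 2k<n) (⊕-fixed x (label-injective g period))
    where
    0<4k : 0 < k + k + (k + k)
    0<4k = <-≤-trans 0<k (≤-trans (m≤m+n k k) (m≤m+n (k + k) (k + k)))
    opposite-pair : ∀ y → M ≡ label g (y ⊕ (k + k)) + label g y
    opposite-pair y = trans (M≡label[u⊕k]+label[u⊖k] 0<k 2k<n (y ⊕ k))
      (cong₂ _+_ (cong (label g) (⊕-assoc y k k)) (cong (label g) (⊕-⊖ (≤-trans (m≤m+n k k) (<⇒≤ 2k<n)) y)))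
    period : label g (x ⊕ (k + k + (k + k))) ≡ label g x
    period = +-cancelʳ-≡ (label g (x ⊕ (k + k))) _ _ (begin
      label g (x ⊕ (k + k + (k + k))) + label g (x ⊕ (k + k))
        ≡⟨ cong (λ v → label g v + label g (x ⊕ (k + k))) (⊕-assoc x (k + k) (k + k)) ⟨
      label g (x ⊕ (k + k) ⊕ (k + k)) + label g (x ⊕ (k + k))  ≡⟨ opposite-pair (x ⊕ (k + k)) ⟨
      M                                                         ≡⟨ opposite-pair x ⟩
      label g (x ⊕ (k + k)) + label g x                         ≡⟨ +-comm _ (label g x) ⟩
      label g x + label g (x ⊕ (k + k))                         ∎)
      where open ≡-Reasoning

  IsKDML⇒n≢k+k : 0 < k → n ≡ k + k → Fin n → ⊥
  IsKDML⇒n≢k+k 0<k n≡2k x = 1≢0 (trans (sym (m<n⇒m%n≡m 1<n)) (⊕-fixed x x⊕1≡x))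
    where
    1<n : 1 < n
    1<n = subst (1 <_) (sym n≡2k) (+-mono-≤ 0<k 0<k)
    1≢0 : 1 ≢ 0
    1≢0 ()
    x⊕1≡x : x ⊕ 1 ≡ x
    x⊕1≡x = ⊕-cancelʳ (≤-trans (m≤m+n k k) (≤-reflexive (sym n≡2k)))
      (label-injective g (trans (sym (M≡label[u⊕k] n≡2k (x ⊕ 1))) (M≡label[u⊕k] n≡2k x)))

KDistanceMagic⇒≡4k : ∀ {n k} {{_ : NonZero n}} → 0 < k → KDistanceMagic (Cycle n) k → n ≡ 4 * k
KDistanceMagic⇒≡4k {n} {k} 0<k ((u₀ , _ , dist₀) , g , M , magic)
  with m≤n⇒m<n∨m≡n (proj₂ (Equivalence.to (Dist⇔Apart {n}) dist₀))
... | inj₁ 2k<n = trans (sym (IsKDML⇒4k≡n {k = k} {g = g} magic 0<k 2k<n u₀)) (sym (4*k≡k+k+[k+k] k))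
... | inj₂ 2k≡n = ⊥-elim (IsKDML⇒n≢k+k {k = k} {g = g} magic 0<k (sym 2k≡n) u₀)

module _ (m : ℕ) where

  reflectUpper : Fin (m + m) → Fin (m + m)
  reflectUpper = join m m ∘ map₂ opposite ∘ splitAt m

  reflectUpper-involutive : ∀ x → reflectUpper (reflectUpper x) ≡ x
  reflectUpper-involutive x = begin
    join m m (map₂ opposite (splitAt m (join m m (map₂ opposite (splitAt m x)))))
      ≡⟨ cong (join m m ∘ map₂ opposite) (splitAt-join m m (map₂ opposite (splitAt m x))) ⟩
    join m m (map₂ opposite (map₂ opposite (splitAt m x)))
      ≡⟨ cong (join m m) (map₂-opposite-involutive (splitAt m x)) ⟩
    join m m (splitAt m x)
      ≡⟨ join-splitAt m m x ⟩
    x ∎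
    where
    open ≡-Reasoning
    map₂-opposite-involutive : ∀ (s : Fin m ⊎ Fin m) → map₂ opposite (map₂ opposite s) ≡ s
    map₂-opposite-involutive (inj₁ i) = refl
    map₂-opposite-involutive (inj₂ i) = cong inj₂ (opposite-involutive i)

  reflectUpper-bijection : Fin (m + m) ⤖ Fin (m + m)
  reflectUpper-bijection = ↔⇒⤖ (mk↔ₛ′ reflectUpper reflectUpper reflectUpper-involutive reflectUpper-involutive)

  reflectUpper-↑ˡ : ∀ i → reflectUpper (i ↑ˡ m) ≡ i ↑ˡ m
  reflectUpper-↑ˡ i = cong (join m m ∘ map₂ opposite) (splitAt-↑ˡ m i m)

  reflectUpper-↑ʳ : ∀ i → reflectUpper (m ↑ʳ i) ≡ m ↑ʳ opposite i
  reflectUpper-↑ʳ i = cong (join m m ∘ map₂ opposite) (splitAt-↑ʳ m m i)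

  halves-label-sum : ∀ i →
    label reflectUpper-bijection (i ↑ˡ m) + label reflectUpper-bijection (m ↑ʳ i) ≡ suc (m + m)
  halves-label-sum i = begin
    suc (toℕ (reflectUpper (i ↑ˡ m))) + suc (toℕ (reflectUpper (m ↑ʳ i)))
      ≡⟨ cong₂ (λ a b → suc a + suc b) (trans (cong toℕ (reflectUpper-↑ˡ i)) (toℕ-↑ˡ i m))
                                        (trans (cong toℕ (reflectUpper-↑ʳ i))
                                               (trans (toℕ-↑ʳ m (opposite i)) (cong (m +_) (opposite-prop i)))) ⟩
    suc (toℕ i) + suc (m + (m ∸ suc (toℕ i)))
      ≡⟨ rearrange (toℕ i) m (m ∸ suc (toℕ i)) ⟩
    suc (m + (m ∸ suc (toℕ i) + suc (toℕ i)))
      ≡⟨ cong (λ r → suc (m + r)) (m∸n+n≡m (toℕ<n i)) ⟩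
    suc (m + m) ∎
    where
    open ≡-Reasoning
    rearrange : ∀ j m r → suc j + suc (m + r) ≡ suc (m + (r + suc j))
    rearrange = solve-∀

module _ {m : ℕ} {{_ : NonZero (m + m)}} where

  ↑ˡ-⊕-half : ∀ i → (i ↑ˡ m) ⊕ m ≡ m ↑ʳ i
  ↑ˡ-⊕-half i = toℕ-injective (begin
    toℕ ((i ↑ˡ m) ⊕ m)        ≡⟨ toℕ-⊕ (i ↑ˡ m) m ⟩
    (toℕ (i ↑ˡ m) + m) % (m + m) ≡⟨ cong (λ j → (j + m) % (m + m)) (toℕ-↑ˡ i m) ⟩
    (toℕ i + m) % (m + m)     ≡⟨ m<n⇒m%n≡m (+-monoˡ-< m (toℕ<n i)) ⟩
    toℕ i + m                 ≡⟨ +-comm (toℕ i) m ⟩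
    m + toℕ i                 ≡⟨ toℕ-↑ʳ m i ⟨
    toℕ (m ↑ʳ i)              ∎)
    where open ≡-Reasoning

  ↑ʳ-⊕-half : ∀ i → (m ↑ʳ i) ⊕ m ≡ i ↑ˡ m
  ↑ʳ-⊕-half i = toℕ-injective (begin
    toℕ ((m ↑ʳ i) ⊕ m)           ≡⟨ toℕ-⊕ (m ↑ʳ i) m ⟩
    (toℕ (m ↑ʳ i) + m) % (m + m) ≡⟨ cong (λ j → (j + m) % (m + m)) (toℕ-↑ʳ m i) ⟩
    (m + toℕ i + m) % (m + m)    ≡⟨ cong (_% (m + m)) (trans (cong (_+ m) (+-comm m (toℕ i))) (+-assoc (toℕ i) m m)) ⟩
    (toℕ i + (m + m)) % (m + m)  ≡⟨ [m+n]%n≡m%n (toℕ i) (m + m) ⟩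
    toℕ i % (m + m)              ≡⟨ m<n⇒m%n≡m (≤-trans (toℕ<n i) (m≤m+n m m)) ⟩
    toℕ i                        ≡⟨ toℕ-↑ˡ i m ⟨
    toℕ (i ↑ˡ m)                 ∎)
    where open ≡-Reasoning

  label-antipodal : ∀ x → label (reflectUpper-bijection m) x + label (reflectUpper-bijection m) (x ⊕ m) ≡ suc (m + m)
  label-antipodal x = subst (λ y → lab y + lab (y ⊕ m) ≡ suc (m + m)) (join-splitAt m m x) (onHalves (splitAt m x))
    where
    lab : Fin (m + m) → ℕ
    lab = label (reflectUpper-bijection m)
    onHalves : ∀ s → lab (join m m s) + lab (join m m s ⊕ m) ≡ suc (m + m)
    onHalves (inj₁ i) = trans (cong (λ y → lab (i ↑ˡ m) + lab y) (↑ˡ-⊕-half i)) (halves-label-sum m i)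
    onHalves (inj₂ i) = trans (cong (λ y → lab (m ↑ʳ i) + lab y) (↑ʳ-⊕-half i))
                              (trans (+-comm (lab (m ↑ʳ i)) (lab (i ↑ˡ m))) (halves-label-sum m i))

module _ {k : ℕ} {{_ : NonZero (k + k + (k + k))}} (0<k : 0 < k) where

  private
    2k<4k : k + k < k + k + (k + k)
    2k<4k = m<m+n (k + k) (<-≤-trans 0<k (m≤m+n k k))

  reflectUpper-SphereSum : ∀ u →
    SphereSum (Cycle (k + k + (k + k))) k (label (reflectUpper-bijection (k + k))) u (suc (k + k + (k + k)))
  reflectUpper-SphereSum u = sphere k u , sphere-unique 0<k 2k<4k , ∈-sphere⇔Dist (<⇒≤ 2k<4k) , pair-sum
    where
    lab : Fin (k + k + (k + k)) → ℕ
    lab = label (reflectUpper-bijection (k + k))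
    pair-sum : lab (u ⊕ k) + (lab (u ⊖ k) + 0) ≡ suc (k + k + (k + k))
    pair-sum = begin
      lab (u ⊕ k) + (lab (u ⊖ k) + 0)  ≡⟨ cong₂ (λ v r → lab v + r) (sym u⊖k⊕2k≡u⊕k) (+-identityʳ _) ⟩
      lab (u ⊖ k ⊕ (k + k)) + lab (u ⊖ k) ≡⟨ +-comm _ (lab (u ⊖ k)) ⟩
      lab (u ⊖ k) + lab (u ⊖ k ⊕ (k + k)) ≡⟨ label-antipodal {k + k} (u ⊖ k) ⟩
      suc (k + k + (k + k))             ∎
      where
      open ≡-Reasoning
      u⊖k⊕2k≡u⊕k : u ⊖ k ⊕ (k + k) ≡ u ⊕ k
      u⊖k⊕2k≡u⊕k =
        trans (sym (⊕-assoc (u ⊖ k) k k)) (cong (_⊕ k) (⊖-⊕ (≤-trans (m≤m+n k k) (<⇒≤ 2k<4k)) u))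

  Cycle[4k]-KDistanceMagic : KDistanceMagic (Cycle (k + k + (k + k))) k
  Cycle[4k]-KDistanceMagic =
    (vertex₀ , vertex₀ ⊕ k , Dist-⊕ (<⇒≤ 2k<4k) vertex₀) ,
    reflectUpper-bijection (k + k) , suc (k + k + (k + k)) , λ u _ → reflectUpper-SphereSum u
    where
    vertex₀ : Fin (k + k + (k + k))
    vertex₀ = fromℕ< (>-nonZero⁻¹ (k + k + (k + k)))

theorem2p6 : (k n : ℕ) → 2 ≤ k → 3 ≤ n →
    KDistanceMagic (Cycle n) k ⇔ (n ≡ 4 * k)
theorem2p6 k@(suc _) n@(suc _) (s≤s _) (s≤s _) = mk⇔ (KDistanceMagic⇒≡4k z<s) ≡4k⇒KDistanceMagic
  where
  ≡4k⇒KDistanceMagic : n ≡ 4 * k → KDistanceMagic (Cycle n) k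
  ≡4k⇒KDistanceMagic n≡4k =
    subst (λ n → KDistanceMagic (Cycle n) k) (sym (trans n≡4k (4*k≡k+k+[k+k] k))) (Cycle[4k]-KDistanceMagic z<s)
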